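{- Let $G$ be the $n$-full oriented hypergraph of an $n\times n$ $\{\pm1\}$-matrix and let $\alpha$ be a permutation of $\{1,\dots,n\}$. The set consisting of $c_{id}\in\mathcal{A}_\alpha$ (the contributor of $\mathcal{A}_\alpha$ consisting only of backsteps) together with the adjacency-inverses of the elements of $\mathcal{A}_\alpha$ is an edge-monic head-equivalence class. Moreover, every edge-monic head-equivalence class of $G$ is obtained in this way from some edge-monic tail-equivalence class $\mathcal{A}_\alpha$.
   Context: Let $H=(h_{ij})$ be an $n\times n$ $\{\pm1\}$-matrix. Its $n$-full oriented hypergraph $G$ has vertices $v_1,\dots,v_n$, edges $e_1,\dots,e_n$, and exactly one incidence $(v_i,e_j)$ for each pair $i,j$, with orientation $\sigma(v_i,e_j)=h_{ij}$. A step is a triple $(v,e,w)$ (tail vertex $v$, edge $e$, head vertex $w$), using tail incidence $(v,e)$ and head incidence $(w,e)$; it is a backstep if $w=v$. A contributor $c$ consists of one step $(v,f(v),\pi(v))$ for each vertex $v$, where $f:V\to E$ is any function and $\pi:V\to V$ is a bijection. Two contributors are tail-equivalent (resp. head-equivalent) if they have the same set of tail incidences $\{(v,f(v))\}$ (resp. the same set of head incidences $\{(\pi(v),f(v))\}$). A tail-equivalence class is edge-monic if its tail incidences lie in pairwise distinct edges; a head-equivalence class is edge-monic if its head incidences lie in pairwise distinct edges. For a permutation $\alpha$ of $\{1,\dots,n\}$, $\mathcal{A}_\alpha$ is the edge-monic tail-equivalence class with $f(v_k)=e_{\alpha(k)}$ for all $k$. The adjacency-inverse of a contributor $c$ with steps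 $(v,f(v),\pi(v))$ is its direction reversal, the contributor with steps $(\pi(v),f(v),v)$, $v\in V$ (it uses the same adjacencies traversed in the opposite direction and corresponds to the inverse permutation). -}

module Defs where

open import Data.Nat using (ℕ)
open import Data.Fin using (Fin)
open import Data.Fin.Permutation using (Permutation′; _⟨$⟩ʳ_; _⟨$⟩ˡ_; flip)
  renaming (id to idPerm)
open import Data.Product using (Σ; ∃; _×_; _,_; proj₁; proj₂)
open import Data.Sum using (_⊎_)
open import Relation.Binary.PropositionalEquality using (_≡_)
open import Function.Bundles using (_⇔_)

data Sign : Set where
  plus minus : Sign

-- n×n {±1}-matrix H; its n-full oriented hypergraph has vertices v_i = Fin n,
-- edges e_j = Fin n, and exactly one incidence (v_i , e_j) for each pair, with
-- orientation σ(v_i , e_j) = H i j.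
SignMatrix : ℕ → Set
SignMatrix n = Fin n → Fin n → Sign

module FullHypergraph {n : ℕ} (H : SignMatrix n) where

  Vertex : Set
  Vertex = Fin n

  Edge : Set
  Edge = Fin n

  σ : Vertex → Edge → Sign
  σ = H

  -- A contributor: a step (v , f v , π v) for each vertex v,
  -- with f : V → E arbitrary and π : V → V a bijection.
  record Contributor : Set where
    constructor contributor
    field
      f : Vertex → Edge
      π : Permutation′ n
  open Contributor public

  _≈C_ : Contributor → Contributor → Set
  c ≈C d = ∀ v → (f c v ≡ f d v) × (π c ⟨$⟩ʳ v ≡ π d ⟨$⟩ʳ v)

  TailInc : Contributor → Vertex → Edge → Set
  TailInc c w e = Σ Vertex λ v → (v ≡ w) × (f c v ≡ e)

  HeadInc : Contributor → Vertex → Edge → Set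
  HeadInc c w e = Σ Vertex λ v → (π c ⟨$⟩ʳ v ≡ w) × (f c v ≡ e)

  TailEquiv : Contributor → Contributor → Set
  TailEquiv c d = ∀ w e → TailInc c w e ⇔ TailInc d w e

  HeadEquiv : Contributor → Contributor → Set
  HeadEquiv c d = ∀ w e → HeadInc c w e ⇔ HeadInc d w e

  CSet : Set₁
  CSet = Contributor → Set

  _≐_ : CSet → CSet → Set
  X ≐ Y = ∀ c → X c ⇔ Y c

  IsHeadClassOf : Contributor → CSet → Set
  IsHeadClassOf c X = ∀ d → X d ⇔ HeadEquiv c d

  IsHeadClass : CSet → Set
  IsHeadClass X = Σ Contributor λ c → IsHeadClassOf c X

  HeadEdgeMonic : Contributor → Set
  HeadEdgeMonic c = ∀ w w' e → HeadInc c w e → HeadInc c w' e → w ≡ w'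

  IsEdgeMonicHeadClass : CSet → Set
  IsEdgeMonicHeadClass X =
    Σ Contributor λ c → IsHeadClassOf c X × HeadEdgeMonic c

  𝒜 : Permutation′ n → CSet
  𝒜 α c = ∀ k → f c k ≡ α ⟨$⟩ʳ k

  cid : Permutation′ n → Contributor
  cid α = contributor (λ k → α ⟨$⟩ʳ k) idPerm

  -- adjacency-inverse (direction reversal): steps (π v , f v , v),
  -- i.e. for tail vertex w the step (w , f (π⁻¹ w) , π⁻¹ w).
  adjInv : Contributor → Contributor
  adjInv c = contributor (λ w → f c (π c ⟨$⟩ˡ w)) (flip (π c))

  𝒜Inv : Permutation′ n → CSet
  𝒜Inv α c = (c ≈C cid α) ⊎ (Σ Contributor λ d → 𝒜 α d × (c ≈C adjInv d))

-- A contributor's head incidences are exactly the graph of its head map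
-- w ↦ f (π⁻¹ w), the edge of the step arriving at w.  Head equivalence is
-- therefore equality of head maps, edge-monicity is injectivity of the head
-- map, and the adjacency-inverses of 𝒜_α (together with c_id) are precisely
-- the contributors whose head map is α.  An injective head map on the finite
-- vertex set is a permutation β, so every edge-monic head class is 𝒜Inv β.
module Submission where

open import Defs
open import Data.Nat using (ℕ; suc)
open import Data.Nat.Properties using (1+n≰n)
open import Data.Fin using (Fin; punchOut)
open import Data.Fin.Properties using (any?; _≟_; injective⇒≤; punchOut-injective)
open import Data.Fin.Permutation using (Permutation′; _⟨$⟩ʳ_; _⟨$⟩ˡ_; permutation; flip; inverseˡ; inverseʳ)
open import Data.Product using (Σ; _×_; _,_; proj₁; proj₂)
open import Data.Sum using (inj₁; inj₂)
open import Function using (_∘_)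
open import Function.Bundles using (_⇔_; mk⇔; Injection; module Equivalence)
open import Function.Definitions using (Injective; StrictlySurjective)
open import Function.Properties.Equivalence using (⇔-setoid)
open import Function.Properties.Inverse using (↔⇒↣)
open import Function.Construct.Composition using (_⇔-∘_)
open import Function.Construct.Symmetry using (⇔-sym)
open import Level using (0ℓ)
open import Relation.Binary.PropositionalEquality
import Relation.Binary.Reasoning.Setoid as ≈-Reasoning
open import Relation.Nullary using (yes; no)
open import Relation.Nullary.Negation using (contradiction)
open FullHypergraph
open Equivalence using (to; from)

injective⇒strictlySurjective : ∀ {n} {g : Fin n → Fin n} →
  Injective _≡_ _≡_ g → StrictlySurjective _≡_ g
injective⇒strictlySurjective {suc m} {g} g-inj y with any? (λ x → g x ≟ y)
... | yes found = found
... | no missed = contradiction (injective⇒≤ g-avoiding-y-injective) 1+n≰n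
  where
  g≢y : ∀ x → y ≢ g x
  g≢y x = missed ∘ (x ,_) ∘ sym

  g-avoiding-y : Fin (suc m) → Fin m
  g-avoiding-y x = punchOut (g≢y x)

  g-avoiding-y-injective : Injective _≡_ _≡_ g-avoiding-y
  g-avoiding-y-injective {x} {x′} = g-inj ∘ punchOut-injective (g≢y x) (g≢y x′)

injective⇒permutation : ∀ {n} (g : Fin n → Fin n) → Injective _≡_ _≡_ g → Permutation′ n
injective⇒permutation g g-inj =
  permutation g (proj₁ ∘ surj) (proj₂ ∘ surj) (λ x → g-inj (proj₂ (surj (g x))))
  where
  surj : StrictlySurjective _≡_ g
  surj = injective⇒strictlySurjective g-inj

module _ {n : ℕ} (H : SignMatrix n) where

  headEdge : Contributor H → Vertex H → Edge H
  headEdge c w = f c (π c ⟨$⟩ˡ w)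

  HeadMap : (Vertex H → Edge H) → Contributor H → Set
  HeadMap g c = ∀ v → f c v ≡ g (π c ⟨$⟩ʳ v)

  headMap-headEdge : ∀ c → HeadMap (headEdge c) c
  headMap-headEdge c v = cong (f c) (sym (inverseˡ (π c)))

  headMap⇔headEdge : ∀ g c → HeadMap g c ⇔ (headEdge c ≗ g)
  headMap⇔headEdge g c = mk⇔
    (λ c-g w → trans (c-g _) (cong g (inverseʳ (π c))))
    (λ c≗g v → trans (headMap-headEdge c v) (c≗g _))

  headInc⇔headEdge : ∀ c w e → HeadInc H c w e ⇔ (headEdge c w ≡ e)
  headInc⇔headEdge c w e = mk⇔
    (λ { (v , refl , refl) → sym (headMap-headEdge c v) })
    (λ { refl → π c ⟨$⟩ˡ w , inverseʳ (π c) , refl })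

  headEquiv⇔headEdge : ∀ c d → HeadEquiv H c d ⇔ (headEdge c ≗ headEdge d)
  headEquiv⇔headEdge c d = mk⇔
    (λ c~d w → sym (to (inc d w _) (to (c~d w _) (from (inc c w _) refl))))
    (λ c≗d w e → mk⇔
      (λ i → from (inc d w e) (trans (sym (c≗d w)) (to (inc c w e) i)))
      (λ i → from (inc c w e) (trans (c≗d w) (to (inc d w e) i))))
    where
    inc : ∀ x w e → HeadInc H x w e ⇔ (headEdge x w ≡ e)
    inc = headInc⇔headEdge

  headEdgeMonic⇔injective : ∀ c → HeadEdgeMonic H c ⇔ Injective _≡_ _≡_ (headEdge c)
  headEdgeMonic⇔injective c = mk⇔
    (λ monic {w} {w′} eq → monic w w′ _ (from (inc w _) eq) (from (inc w′ _) refl))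
    (λ inj w w′ e i i′ → inj (trans (to (inc w e) i) (sym (to (inc w′ e) i′))))
    where
    inc : ∀ w e → HeadInc H c w e ⇔ (headEdge c w ≡ e)
    inc = headInc⇔headEdge c

  𝒜Inv⇔headMap : ∀ β d → 𝒜Inv H β d ⇔ HeadMap (β ⟨$⟩ʳ_) d
  𝒜Inv⇔headMap β d = mk⇔
    (λ { (inj₁ d≈cid) v → trans (proj₁ (d≈cid v)) (cong (β ⟨$⟩ʳ_) (sym (proj₂ (d≈cid v))))
       ; (inj₂ (d′ , d′∈𝒜 , d≈d′⁻¹)) v →
           trans (proj₁ (d≈d′⁻¹ v)) (trans (d′∈𝒜 _) (cong (β ⟨$⟩ʳ_) (sym (proj₂ (d≈d′⁻¹ v))))) })
    -- d is the adjacency-inverse of its own reversal, whose tails follow β.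
    (λ d-β → inj₂ (contributor (β ⟨$⟩ʳ_) (flip (π d)) , (λ _ → refl) , λ v → d-β v , refl))

  𝒜Inv-isHeadClassOf : ∀ β c → headEdge c ≗ (β ⟨$⟩ʳ_) → IsHeadClassOf H c (𝒜Inv H β)
  𝒜Inv-isHeadClassOf β c c≗β d = begin
    𝒜Inv H β d                    ≈⟨ 𝒜Inv⇔headMap β d ⟩
    HeadMap (β ⟨$⟩ʳ_) d           ≈⟨ headMap⇔headEdge _ d ⟩
    headEdge d ≗ (β ⟨$⟩ʳ_)        ≈⟨ mk⇔ (λ d≗β w → trans (c≗β w) (sym (d≗β w)))
                                          (λ c≗d w → trans (sym (c≗d w)) (c≗β w)) ⟩
    headEdge c ≗ headEdge d       ≈⟨ ⇔-sym (headEquiv⇔headEdge c d) ⟩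
    HeadEquiv H c d               ∎
    where open ≈-Reasoning (⇔-setoid 0ℓ)

corollary4 : (n : ℕ) (H : SignMatrix n) (α : Permutation′ n) →
    (IsEdgeMonicHeadClass H (𝒜Inv H α)) ×
    ((X : CSet H) → IsEdgeMonicHeadClass H X →
      Σ (Permutation′ n) λ β → _≐_ H X (𝒜Inv H β))
corollary4 n H α = 𝒜Inv-edgeMonicHeadClass , edgeMonicHeadClass-𝒜Inv
  where
  𝒜Inv-edgeMonicHeadClass : IsEdgeMonicHeadClass H (𝒜Inv H α)
  𝒜Inv-edgeMonicHeadClass =
    cid H α ,
    𝒜Inv-isHeadClassOf H α (cid H α) (λ _ → refl) ,
    from (headEdgeMonic⇔injective H (cid H α)) (Injection.injective (↔⇒↣ α))

  edgeMonicHeadClass-𝒜Inv : (X : CSet H) → IsEdgeMonicHeadClass H X →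
    Σ (Permutation′ n) λ β → _≐_ H X (𝒜Inv H β)
  edgeMonicHeadClass-𝒜Inv X (c , X-class , c-monic) =
    β , λ d → ⇔-sym (𝒜Inv-isHeadClassOf H β c (λ _ → refl) d) ⇔-∘ X-class d
    where
    β : Permutation′ n
    β = injective⇒permutation (headEdge H c) (to (headEdgeMonic⇔injective H c) c-monic)
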